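{- The partially ordered sets of equivalence classes of parameterizations obtained from $\preccurlyeq_{\mathrm{nu}}$ and from $\preccurlyeq$ are lattices: any two equivalence classes have a least upper bound and a greatest lower bound.
   Context: A parameter space is a nonempty set $\Omega$ with a reflexive, transitive relation $\preccurlyeq$ that is directed (for all $a,b$ there is $c$ with $a\preccurlyeq c$, $b\preccurlyeq c$), together with an injective encoding into $\{0,1\}^+$; $|k|$ is the encoding length. A parameterization over $\Omega$ is $\eta\subseteq\{0,1\}^+\times\Omega$ such that for every $x$ the set $\{k:(x,k)\in\eta\}$ is nonempty and upward closed. $\mu_\eta(x)=\min\{|k|:(x,k)\in\eta\}$. For parameterizations $\eta_1,\eta_2$ (possibly over different parameter spaces), $\mathrm{gap}_{\eta_1,\eta_2}(n)=\max\{\mu_{\eta_1}(x):x\in\{0,1\}^+,\ \mu_{\eta_2}(x)\le n\}\in\mathbb N\cup\{\infty\}$ (max of the empty set is $0$). $\eta_1\preccurlyeq_{\mathrm{nu}}\eta_2$ if $\mathrm{gap}_{\eta_1,\eta_2}(n)<\infty$ for all $n$; $\eta_1\preccurlyeq\eta_2$ if $\mathrm{gap}_{\eta_1,\eta_2}$ is bounded above by a computable function. Both are reflexive and transitive; equivalence classes are taken w.r.t. $\eta_1\preccurlyeq\eta_2\wedge\eta_2\preccurlyeq\eta_1$ (resp. for $\preccurlyeq_{\mathrm{nu}}$), partially ordered by the induced order. -}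

module Defs where

open import Data.Nat using (ℕ; zero; suc; _≤_; _<_)
open import Data.Bool using (Bool)
open import Data.List.NonEmpty using (List⁺; length)
open import Data.Fin using (Fin)
open import Data.Vec using (Vec; []; _∷_; lookup)
open import Data.Product using (Σ; ∃; _×_; _,_)
open import Relation.Binary.PropositionalEquality using (_≡_)

BitString : Set
BitString = List⁺ Bool

record ParameterSpace : Set₁ where
  field
    Carrier   : Set
    _≼_       : Carrier → Carrier → Set
    ≼-refl    : ∀ a → a ≼ a
    ≼-trans   : ∀ {a b c} → a ≼ b → b ≼ c → a ≼ c
    directed  : ∀ a b → Σ Carrier λ c → (a ≼ c) × (b ≼ c)
    enc       : Carrier → BitString
    enc-inj   : ∀ {a b} → enc a ≡ enc b → a ≡ b

  ∣_∣ : Carrier → ℕ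
  ∣ k ∣ = length (enc k)

-- Parameterizations (bundled with their parameter space, since the
-- orders compare parameterizations over possibly different spaces)

record Parameterization : Set₁ where
  field
    space : ParameterSpace
  open ParameterSpace space public
  field
    η          : BitString → Carrier → Set
    nonempty   : ∀ x → Σ Carrier λ k → η x k
    upward     : ∀ x {k k'} → k ≼ k' → η x k → η x k'

open Parameterization

-- μ_η(x) ≤ n   (μ_η(x) = min { |k| : (x,k) ∈ η })
μ≤ : Parameterization → BitString → ℕ → Set
μ≤ P x n = Σ (Carrier P) λ k → η P x k × (∣_∣ P k ≤ n)

-- gap_{η₁,η₂}(n) ≤ b
GapBound : Parameterization → Parameterization → ℕ → ℕ → Set
GapBound P₁ P₂ n b = ∀ x → μ≤ P₂ x n → μ≤ P₁ x b

data Code : ℕ → Set where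
  zeroᶜ : ∀ {n} → Code n
  succᶜ : Code 1
  projᶜ : ∀ {n} → Fin n → Code n
  compᶜ : ∀ {m n} → Code m → Vec (Code n) m → Code n
  precᶜ : ∀ {n} → Code n → Code (suc (suc n)) → Code (suc n)
  minᶜ  : ∀ {n} → Code (suc n) → Code n

mutual
  data _[_]⇓_ : ∀ {n} → Code n → Vec ℕ n → ℕ → Set where
    ⇓zero : ∀ {n} {xs : Vec ℕ n} → zeroᶜ [ xs ]⇓ 0
    ⇓succ : ∀ {x} → succᶜ [ x ∷ [] ]⇓ suc x
    ⇓proj : ∀ {n} {xs : Vec ℕ n} (i : Fin n) → projᶜ i [ xs ]⇓ lookup xs i
    ⇓comp : ∀ {m n} {f : Code m} {gs : Vec (Code n) m} {xs ys z} →
            gs [ xs ]⇓* ys → f [ ys ]⇓ z → compᶜ f gs [ xs ]⇓ z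
    ⇓prec0 : ∀ {n} {f : Code n} {g xs z} →
             f [ xs ]⇓ z → precᶜ f g [ 0 ∷ xs ]⇓ z
    ⇓precS : ∀ {n} {f : Code n} {g xs k r z} →
             precᶜ f g [ k ∷ xs ]⇓ r → g [ k ∷ r ∷ xs ]⇓ z →
             precᶜ f g [ suc k ∷ xs ]⇓ z
    ⇓min : ∀ {n} {f : Code (suc n)} {xs k} →
           f [ k ∷ xs ]⇓ 0 →
           (∀ j → j < k → Σ ℕ λ r → f [ j ∷ xs ]⇓ suc r) →
           minᶜ f [ xs ]⇓ k

  data _[_]⇓*_ : ∀ {m n} → Vec (Code n) m → Vec ℕ n → Vec ℕ m → Set where
    ⇓[] : ∀ {n} {xs : Vec ℕ n} → [] [ xs ]⇓* []
    ⇓∷  : ∀ {m n} {g : Code n} {gs : Vec (Code n) m} {xs y ys} →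
          g [ xs ]⇓ y → gs [ xs ]⇓* ys → (g ∷ gs) [ xs ]⇓* (y ∷ ys)

Computable : (ℕ → ℕ) → Set
Computable f = Σ (Code 1) λ c → ∀ n → c [ n ∷ [] ]⇓ f n

_≼nu_ : Parameterization → Parameterization → Set
P₁ ≼nu P₂ = ∀ n → Σ ℕ λ b → GapBound P₁ P₂ n b

_≼ₚ_ : Parameterization → Parameterization → Set
P₁ ≼ₚ P₂ = Σ (ℕ → ℕ) λ f → Computable f × (∀ n → GapBound P₁ P₂ n (f n))

-- Least upper bounds / greatest lower bounds of equivalence classes,
-- unfolded to the underlying preorder (well-defined on classes).

HasLub : (Parameterization → Parameterization → Set) →
         Parameterization → Parameterization → Set₁
HasLub _⊑_ P Q = Σ Parameterization λ J →
  (P ⊑ J) × (Q ⊑ J) × (∀ R → P ⊑ R → Q ⊑ R → J ⊑ R)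

HasGlb : (Parameterization → Parameterization → Set) →
         Parameterization → Parameterization → Set₁
HasGlb _⊑_ P Q = Σ Parameterization λ M →
  (M ⊑ P) × (M ⊑ Q) × (∀ R → R ⊑ P → R ⊑ Q → R ⊑ M)

IsLatticeOfClasses : (Parameterization → Parameterization → Set) → Set₁
IsLatticeOfClasses _⊑_ = ∀ P Q → HasLub _⊑_ P Q × HasGlb _⊑_ P Q

-- The join of η₁ and η₂ takes pairs of parameters (k₁ , k₂) and asks for
-- both memberships; the meet takes pairs of optional parameters and asks for
-- either membership. Encoding a pair by a prefix-free code of the first
-- component followed by the second makes its length pairLength ∣k₁∣ ∣k₂∣,
-- which is monotone and dominates both lengths. Every gap bound needed for
-- the lattice properties is therefore obtained from the given ones by id,
-- suc, + and pairLength, so it is finite, and computable when they are.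
module Submission where

open import Defs
open import Data.Bool using (Bool; true; false)
open import Data.Empty using (⊥)
open import Data.Unit using (⊤; tt)
open import Data.Fin using () renaming (zero to fzero; suc to fsuc)
open import Data.List using (List; []; _∷_; _++_)
import Data.List as List
open import Data.List.Properties using (length-++; ∷-injective; ∷-injectiveʳ)
open import Data.List.NonEmpty using (toList; length; tail) renaming (_∷_ to _∷⁺_)
open import Data.Nat using (ℕ; zero; suc; _+_; _≤_; z≤n; s≤s)
open import Data.Nat.Properties
  using (≤-reflexive; ≤-trans; <⇒≤; +-mono-≤; +-suc; m≤m+n; m≤n+m; m≤n⇒m≤1+n; m≤n⇒m≤n+o)
open import Data.Product using (Σ; _×_; _,_; proj₁; proj₂)
open import Data.Product.Relation.Binary.Pointwise.NonDependent using (Pointwise)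
open import Data.Sum using (_⊎_; inj₁; inj₂)
open import Data.Vec using () renaming ([] to []ᵥ; _∷_ to _∷ᵥ_)
open import Function using (id)
open import Relation.Binary.PropositionalEquality using (_≡_; refl; cong; cong₂; sym; trans)
open import Relation.Nullary.Construct.Add.Infimum using (_₋; ⊥₋; [_])
import Relation.Binary.Construct.Add.Infimum.NonStrict as AddInfimum

open Parameterization using (Carrier; η)

pairLength : ℕ → ℕ → ℕ
pairLength m n = suc (suc (m + m) + n)

pairLength-mono-≤ : ∀ {m m′ n n′} → m ≤ m′ → n ≤ n′ → pairLength m n ≤ pairLength m′ n′
pairLength-mono-≤ m≤m′ n≤n′ = s≤s (+-mono-≤ (s≤s (+-mono-≤ m≤m′ m≤m′)) n≤n′)

m≤pairLength : ∀ m n → m ≤ pairLength m n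
m≤pairLength m n = m≤n⇒m≤1+n (m≤n⇒m≤n+o n (m≤n⇒m≤1+n (m≤m+n m m)))

n≤pairLength : ∀ m n → n ≤ pairLength m n
n≤pairLength m n = m≤n+m n (suc (suc (m + m)))

prefixCode : List Bool → List Bool
prefixCode []      = false ∷ []
prefixCode (b ∷ w) = true ∷ b ∷ prefixCode w

prefixCode-++-injective : ∀ u v u′ v′ → prefixCode u ++ v ≡ prefixCode u′ ++ v′ → u ≡ u′ × v ≡ v′
prefixCode-++-injective []      v []        v′ refl = refl , refl
prefixCode-++-injective []      v (_ ∷ _)   v′ ()
prefixCode-++-injective (_ ∷ _) v []        v′ ()
prefixCode-++-injective (b ∷ u) v (b′ ∷ u′) v′ eq
  with refl , eq′ ← ∷-injective (∷-injectiveʳ eq)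
  with refl , refl ← prefixCode-++-injective u v u′ v′ eq′
  = refl , refl

length-prefixCode : ∀ u → List.length (prefixCode u) ≡ suc (List.length u + List.length u)
length-prefixCode []      = refl
length-prefixCode (_ ∷ u) =
  cong (λ m → suc (suc m)) (trans (length-prefixCode u) (sym (+-suc (List.length u) (List.length u))))

toList-injective : ∀ {u v : BitString} → toList u ≡ toList v → u ≡ v
toList-injective {_ ∷⁺ _} {_ ∷⁺ _} refl = refl

pair : BitString → BitString → BitString
pair u v = true ∷⁺ (prefixCode (toList u) ++ toList v)

pair-injective : ∀ {u v u′ v′} → pair u v ≡ pair u′ v′ → u ≡ u′ × v ≡ v′
pair-injective {u} {v} {u′} {v′} eq
  with eq₁ , eq₂ ← prefixCode-++-injective (toList u) (toList v) (toList u′) (toList v′)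
                                            (∷-injectiveʳ (cong toList eq))
  = toList-injective eq₁ , toList-injective eq₂

length-pair : ∀ u v → length (pair u v) ≡ pairLength (length u) (length v)
length-pair u v =
  cong suc (trans (length-++ (prefixCode (toList u))) (cong (_+ length v) (length-prefixCode (toList u))))

module _ (S T : ParameterSpace) where
  private
    module S = ParameterSpace S
    module T = ParameterSpace T

  infixr 2 _⊗_
  _⊗_ : ParameterSpace
  _⊗_ = record
    { Carrier  = S.Carrier × T.Carrier
    ; _≼_      = Pointwise S._≼_ T._≼_
    ; ≼-refl   = λ (k , l) → S.≼-refl k , T.≼-refl l
    ; ≼-trans  = λ (k≼k′ , l≼l′) (k′≼k″ , l′≼l″) → S.≼-trans k≼k′ k′≼k″ , T.≼-trans l≼l′ l′≼l″
    ; directed = λ (k , l) (k′ , l′) →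
        let (c , k≼c , k′≼c) = S.directed k k′
            (d , l≼d , l′≼d) = T.directed l l′
        in (c , d) , (k≼c , l≼d) , (k′≼c , l′≼d)
    ; enc      = λ (k , l) → pair (S.enc k) (T.enc l)
    ; enc-inj  = λ eq → let (eq₁ , eq₂) = pair-injective eq
                        in cong₂ _,_ (S.enc-inj eq₁) (T.enc-inj eq₂)
    }

  open ParameterSpace _⊗_ using () renaming (∣_∣ to ∣_∣⊗)

  ∣⊗∣≡pairLength : ∀ k l → ∣ (k , l) ∣⊗ ≡ pairLength S.∣ k ∣ T.∣ l ∣
  ∣⊗∣≡pairLength k l = length-pair (S.enc k) (T.enc l)

  ∣⊗∣≤⇒∣proj₁∣≤ : ∀ k l {n} → ∣ (k , l) ∣⊗ ≤ n → S.∣ k ∣ ≤ n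
  ∣⊗∣≤⇒∣proj₁∣≤ k l ∣kl∣≤n =
    ≤-trans (m≤pairLength S.∣ k ∣ T.∣ l ∣) (≤-trans (≤-reflexive (sym (∣⊗∣≡pairLength k l))) ∣kl∣≤n)

  ∣⊗∣≤⇒∣proj₂∣≤ : ∀ k l {n} → ∣ (k , l) ∣⊗ ≤ n → T.∣ l ∣ ≤ n
  ∣⊗∣≤⇒∣proj₂∣≤ k l ∣kl∣≤n =
    ≤-trans (n≤pairLength S.∣ k ∣ T.∣ l ∣) (≤-trans (≤-reflexive (sym (∣⊗∣≡pairLength k l))) ∣kl∣≤n)

  ∣⊗∣≤pairLength : ∀ k l {m n} → S.∣ k ∣ ≤ m → T.∣ l ∣ ≤ n → ∣ (k , l) ∣⊗ ≤ pairLength m n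
  ∣⊗∣≤pairLength k l ∣k∣≤m ∣l∣≤n = ≤-trans (≤-reflexive (∣⊗∣≡pairLength k l)) (pairLength-mono-≤ ∣k∣≤m ∣l∣≤n)

module _ (S : ParameterSpace) where
  private module S = ParameterSpace S
  open AddInfimum S._≼_

  ≤₋-refl : ∀ a → a ≤₋ a
  ≤₋-refl ⊥₋    = ⊥₋≤ ⊥₋
  ≤₋-refl [ k ] = [ S.≼-refl k ]

  ≤₋-directed : ∀ a b → Σ (S.Carrier ₋) λ c → a ≤₋ c × b ≤₋ c
  ≤₋-directed ⊥₋    b     = b , ⊥₋≤ b , ≤₋-refl b
  ≤₋-directed [ k ] ⊥₋    = [ k ] , ≤₋-refl [ k ] , ⊥₋≤ [ k ]
  ≤₋-directed [ k ] [ l ] = let (c , k≼c , l≼c) = S.directed k l in [ c ] , [ k≼c ] , [ l≼c ]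

  enc₋ : S.Carrier ₋ → BitString
  enc₋ ⊥₋    = false ∷⁺ []
  enc₋ [ k ] = true ∷⁺ toList (S.enc k)

  enc₋-injective : ∀ {a b} → enc₋ a ≡ enc₋ b → a ≡ b
  enc₋-injective {⊥₋}    {⊥₋}    _  = refl
  enc₋-injective {[ k ]} {[ l ]} eq = cong [_] (S.enc-inj (toList-injective (cong tail eq)))

  withBottom : ParameterSpace
  withBottom = record
    { Carrier  = S.Carrier ₋
    ; _≼_      = _≤₋_
    ; ≼-refl   = ≤₋-refl
    ; ≼-trans  = ≤₋-trans S.≼-trans
    ; directed = ≤₋-directed
    ; enc      = enc₋
    ; enc-inj  = enc₋-injective
    }

μ≤-mono : ∀ P x {m n} → m ≤ n → μ≤ P x m → μ≤ P x n
μ≤-mono P x m≤n (k , xk∈η , ∣k∣≤m) = k , xk∈η , ≤-trans ∣k∣≤m m≤n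

module _ (P : Parameterization) where
  open Parameterization P using (_≼_; upward)
  open AddInfimum _≼_

  η₋ : BitString → Carrier P ₋ → Set
  η₋ x ⊥₋    = ⊥
  η₋ x [ k ] = η P x k

  η₋-upward : ∀ x {a b} → a ≤₋ b → η₋ x a → η₋ x b
  η₋-upward x [ k≼k′ ] = upward x k≼k′

meetBound : ℕ → ℕ
meetBound n = pairLength (suc n) (suc n)

GapBoundedBy : (ℕ → ℕ) → Parameterization → Parameterization → Set
GapBoundedBy f P Q = ∀ n → GapBound P Q n (f n)

module _ (P Q : Parameterization) where
  private
    module P = Parameterization P
    module Q = Parameterization Q

  Join : Parameterization
  Join = record
    { space    = P.space ⊗ Q.space
    ; η        = λ x (k , l) → P.η x k × Q.η x l
    ; nonempty = λ x → let (k , xk∈P) = P.nonempty x ; (l , xl∈Q) = Q.nonempty x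
                       in (k , l) , xk∈P , xl∈Q
    ; upward   = λ x (k≼k′ , l≼l′) (xk∈P , xl∈Q) → P.upward x k≼k′ xk∈P , Q.upward x l≼l′ xl∈Q
    }

  join-upperˡ : GapBoundedBy id P Join
  join-upperˡ n x ((k , l) , (xk∈P , _) , ∣kl∣≤n) = k , xk∈P , ∣⊗∣≤⇒∣proj₁∣≤ P.space Q.space k l ∣kl∣≤n

  join-upperʳ : GapBoundedBy id Q Join
  join-upperʳ n x ((k , l) , (_ , xl∈Q) , ∣kl∣≤n) = l , xl∈Q , ∣⊗∣≤⇒∣proj₂∣≤ P.space Q.space k l ∣kl∣≤n

  join-least : ∀ R {f g} → GapBoundedBy f P R → GapBoundedBy g Q R →
               GapBoundedBy (λ n → pairLength (f n) (g n)) Join R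
  join-least R P≤R Q≤R n x x∈R
    with k , xk∈P , ∣k∣≤fn ← P≤R n x x∈R
       | l , xl∈Q , ∣l∣≤gn ← Q≤R n x x∈R
    = (k , l) , (xk∈P , xl∈Q) , ∣⊗∣≤pairLength P.space Q.space k l ∣k∣≤fn ∣l∣≤gn

  private
    P₋ Q₋ : ParameterSpace
    P₋ = withBottom P.space
    Q₋ = withBottom Q.space

  Meet : Parameterization
  Meet = record
    { space    = P₋ ⊗ Q₋
    ; η        = λ x (a , b) → η₋ P x a ⊎ η₋ Q x b
    ; nonempty = λ x → let (k , xk∈P) = P.nonempty x in ([ k ] , ⊥₋) , inj₁ xk∈P
    ; upward   = λ { x (a≤a′ , _) (inj₁ xa∈P) → inj₁ (η₋-upward P x a≤a′ xa∈P)
                   ; x (_ , b≤b′) (inj₂ xb∈Q) → inj₂ (η₋-upward Q x b≤b′ xb∈Q) }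
    }

  meet-lowerˡ : GapBoundedBy meetBound Meet P
  meet-lowerˡ n x (k , xk∈P , ∣k∣≤n) =
    ([ k ] , ⊥₋) , inj₁ xk∈P , ∣⊗∣≤pairLength P₋ Q₋ [ k ] ⊥₋ (s≤s ∣k∣≤n) (s≤s z≤n)

  meet-lowerʳ : GapBoundedBy meetBound Meet Q
  meet-lowerʳ n x (l , xl∈Q , ∣l∣≤n) =
    (⊥₋ , [ l ]) , inj₂ xl∈Q , ∣⊗∣≤pairLength P₋ Q₋ ⊥₋ [ l ] (s≤s z≤n) (s≤s ∣l∣≤n)

  -- ∣ [ k ] ∣ is suc ∣ k ∣, so a component of a witness of size ≤ n has size < n.
  meet-greatest : ∀ R {f g} → GapBoundedBy f R P → GapBoundedBy g R Q →
                  GapBoundedBy (λ n → f n + g n) R Meet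
  meet-greatest R {f} {g} R≤P R≤Q n x (([ k ] , b) , inj₁ xk∈P , ∣kb∣≤n) =
    μ≤-mono R x (m≤m+n (f n) (g n))
      (R≤P n x (k , xk∈P , <⇒≤ (∣⊗∣≤⇒∣proj₁∣≤ P₋ Q₋ [ k ] b ∣kb∣≤n)))
  meet-greatest R {f} {g} R≤P R≤Q n x ((a , [ l ]) , inj₂ xl∈Q , ∣al∣≤n) =
    μ≤-mono R x (m≤n+m (g n) (f n))
      (R≤Q n x (l , xl∈Q , <⇒≤ (∣⊗∣≤⇒∣proj₂∣≤ P₋ Q₋ a [ l ] ∣al∣≤n)))

addᶜ : Code 2
addᶜ = precᶜ (projᶜ fzero) (compᶜ succᶜ (projᶜ (fsuc fzero) ∷ᵥ []ᵥ))

addᶜ-correct : ∀ m n → addᶜ [ m ∷ᵥ n ∷ᵥ []ᵥ ]⇓ (m + n)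
addᶜ-correct zero    n = ⇓prec0 (⇓proj fzero)
addᶜ-correct (suc m) n = ⇓precS (addᶜ-correct m n) (⇓comp (⇓∷ (⇓proj (fsuc fzero)) ⇓[]) ⇓succ)

computable-id : Computable id
computable-id = projᶜ fzero , λ _ → ⇓proj fzero

computable-suc : ∀ {f} → Computable f → Computable (λ n → suc (f n))
computable-suc (c , c⇓f) = compᶜ succᶜ (c ∷ᵥ []ᵥ) , λ n → ⇓comp (⇓∷ (c⇓f n) ⇓[]) ⇓succ

computable-+ : ∀ {f g} → Computable f → Computable g → Computable (λ n → f n + g n)
computable-+ (c , c⇓f) (d , d⇓g) =
  compᶜ addᶜ (c ∷ᵥ d ∷ᵥ []ᵥ) , λ n → ⇓comp (⇓∷ (c⇓f n) (⇓∷ (d⇓g n) ⇓[])) (addᶜ-correct _ _)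

GapBoundedAdmissibly : ((ℕ → ℕ) → Set) → Parameterization → Parameterization → Set
GapBoundedAdmissibly Admissible P Q = Σ (ℕ → ℕ) λ f → Admissible f × GapBoundedBy f P Q

module _ {Admissible : (ℕ → ℕ) → Set}
         (admissible-id : Admissible id)
         (admissible-suc : ∀ {f} → Admissible f → Admissible (λ n → suc (f n)))
         (admissible-+ : ∀ {f g} → Admissible f → Admissible g → Admissible (λ n → f n + g n))
  where

  private
    admissible-pairLength : ∀ {f g} → Admissible f → Admissible g →
                            Admissible (λ n → pairLength (f n) (g n))
    admissible-pairLength af ag = admissible-suc (admissible-+ (admissible-suc (admissible-+ af af)) ag)

    admissible-meetBound : Admissible meetBound
    admissible-meetBound = admissible-pairLength (admissible-suc admissible-id) (admissible-suc admissible-id)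

  GapBoundedAdmissibly-isLatticeOfClasses : IsLatticeOfClasses (GapBoundedAdmissibly Admissible)
  GapBoundedAdmissibly-isLatticeOfClasses P Q =
    (Join P Q , (id , admissible-id , join-upperˡ P Q) , (id , admissible-id , join-upperʳ P Q) ,
       λ { R (_ , af , P≤R) (_ , ag , Q≤R) → _ , admissible-pairLength af ag , join-least P Q R P≤R Q≤R }) ,
    (Meet P Q , (meetBound , admissible-meetBound , meet-lowerˡ P Q) ,
                (meetBound , admissible-meetBound , meet-lowerʳ P Q) ,
       λ { R (_ , af , R≤P) (_ , ag , R≤Q) → _ , admissible-+ af ag , meet-greatest P Q R R≤P R≤Q })

IsLatticeOfClasses-resp-⇔ : ∀ {_⊑_ _⊑′_ : Parameterization → Parameterization → Set} →
                            (∀ {P Q} → P ⊑ Q → P ⊑′ Q) → (∀ {P Q} → P ⊑′ Q → P ⊑ Q) →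
                            IsLatticeOfClasses _⊑_ → IsLatticeOfClasses _⊑′_
IsLatticeOfClasses-resp-⇔ to from lattice P Q
  with (J , P⊑J , Q⊑J , J-least) , (M , M⊑P , M⊑Q , M-greatest) ← lattice P Q
  = (J , to P⊑J , to Q⊑J , λ R P⊑R Q⊑R → to (J-least R (from P⊑R) (from Q⊑R))) ,
    (M , to M⊑P , to M⊑Q , λ R R⊑P R⊑Q → to (M-greatest R (from R⊑P) (from R⊑Q)))

≼nu⇒GapBoundedAdmissibly : ∀ {P Q} → P ≼nu Q → GapBoundedAdmissibly (λ _ → ⊤) P Q
≼nu⇒GapBoundedAdmissibly P≼Q = (λ n → proj₁ (P≼Q n)) , tt , λ n → proj₂ (P≼Q n)

GapBoundedAdmissibly⇒≼nu : ∀ {P Q} → GapBoundedAdmissibly (λ _ → ⊤) P Q → P ≼nu Q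
GapBoundedAdmissibly⇒≼nu (f , _ , P≤Q) n = f n , P≤Q n

lemma3 : IsLatticeOfClasses _≼nu_ × IsLatticeOfClasses _≼ₚ_
lemma3 =
  IsLatticeOfClasses-resp-⇔ (λ {P Q} → GapBoundedAdmissibly⇒≼nu {P} {Q})
                            (λ {P Q} → ≼nu⇒GapBoundedAdmissibly {P} {Q})
    (GapBoundedAdmissibly-isLatticeOfClasses tt (λ _ → tt) (λ _ _ → tt)) ,
  GapBoundedAdmissibly-isLatticeOfClasses computable-id computable-suc computable-+
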